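{- There is an absolute constant $C$ such that for every finite rooted tree $T$ with $|T|=n$ and every integer $k\ge 0$, the number of nodes $u$ of $T$ with $wc(u)=k$ is at most $C\cdot n\cdot\frac{2^k}{2^{2^k}}$.
   Context: For $x>0$, $\lg x=\max(1,\log_2 x)$. In a finite rooted tree $T$, $T_u$ is the subtree rooted at $u$ and $|T_u|$ its number of nodes. Heavy-light decomposition: for a non-leaf node $u$, $heavy(u)$ is a child $v$ of $u$ maximizing $|T_v|$ (one fixed choice); the edge $(u,heavy(u))$ is heavy and all other edges from $u$ to its children are light. A node is an apex node if it is the root or the edge to its parent is light. The light subtree of $u$ is $T_u^\ell=T_u\setminus T_{heavy(u)}$ (for a leaf, $T_u^\ell=\{u\}$). Define $\gamma(u)=\lfloor\lg|T_u|\rfloor$ if $u$ is an apex node and $\gamma(u)=\lfloor\lg|T_u^\ell|\rfloor$ otherwise, and the weight class $wc(u)=\lfloor\lg\gamma(u)\rfloor$. -}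

module Defs where

open import Data.Nat using (ℕ; zero; suc; _+_; _*_; _∸_; _^_; _≤_; _⊔_; _≡ᵇ_)
open import Data.Nat.Logarithm using (⌊log₂_⌋)
open import Data.Bool using (Bool; true; false; if_then_else_)
open import Data.List using (List; []; _∷_; length; lookup; _++_; filter)
open import Data.List.Relation.Unary.All using (All; []; _∷_)
open import Data.Fin using (Fin; toℕ)
open import Data.Nat.Properties using (_≟_)

data Tree : Set where
  node : List Tree → Tree

mutual
  size : Tree → ℕ
  size (node ts) = suc (sizes ts)

  sizes : List Tree → ℕ
  sizes [] = 0
  sizes (t ∷ ts) = size t + sizes ts

-- A heavy-light decomposition of a tree: at every non-leaf node a fixed
-- choice of child i (heavy(u)) maximizing the subtree size among children,
-- recursively in all subtrees.
data HLD : Tree → Set where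
  leafH : HLD (node [])
  nodeH : ∀ {ts} (i : Fin (length ts)) →
          (∀ j → size (lookup ts j) ≤ size (lookup ts i)) →
          All HLD ts → HLD (node ts)

-- floor of lg x, where lg x = max(1, log2 x):  ⌊lg x⌋ = max(1, ⌊log2 x⌋)
⌊lg_⌋ : ℕ → ℕ
⌊lg x ⌋ = 1 ⊔ ⌊log₂ x ⌋

-- |T_u^ℓ| : size of the light subtree of the root (for a leaf: 1)
lightSize : (t : Tree) → HLD t → ℕ
lightSize t leafH = size t
lightSize (node ts) (nodeH i _ _) = size (node ts) ∸ size (lookup ts i)

-- γ(u) given whether u is an apex node
γ : (t : Tree) → HLD t → Bool → ℕ
γ t h true  = ⌊lg size t ⌋
γ t h false = ⌊lg lightSize t h ⌋

wcOf : ℕ → ℕ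
wcOf g = ⌊lg g ⌋

mutual
  gammas : (t : Tree) → HLD t → Bool → List ℕ
  gammas t leafH apex = γ t leafH apex ∷ []
  gammas (node ts) (nodeH i p hs) apex =
    γ (node ts) (nodeH i p hs) apex ∷ gammasChildren (toℕ i) 0 hs

  gammasChildren : ∀ {ts} → ℕ → ℕ → All HLD ts → List ℕ
  gammasChildren hp pos [] = []
  gammasChildren {t ∷ _} hp pos (h ∷ hs) =
    gammas t h (if hp ≡ᵇ pos then false else true)
      ++ gammasChildren hp (suc pos) hs

countWC : (t : Tree) → HLD t → ℕ → ℕ
countWC t h k = length (filter (λ g → wcOf g ≟ k) (gammas t h true))

-- A node u of weight class k ≥ 2 has γ(u) ≥ 2^k, so the subtree that defines γ(u) (all of T_u if
-- u is an apex, the light subtree otherwise) has at least M = 2^(2^k) nodes. Give each subtree a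
-- credit: 3 per node while it has fewer than M nodes, and a flat M (apex root) or 2M (heavy-child
-- root) once it is large. Bottom-up, the three units contributed by each node together with the
-- children's credits always pay for M per counted node plus the credit of the new subtree, so at
-- most 3n/M nodes have weight class k. Weight classes 0 and 1 are covered by the trivial bound n.
module Submission where

open import Defs
open import Data.Nat using (ℕ; _*_; _^_; _≤_)
open import Data.Product using (∃-syntax)

open import Data.Nat
  using (zero; suc; _+_; _∸_; _<_; _⊔_; _⊓_; _≤?_; _≟_; _≡ᵇ_; ⌊_/2⌋; ⌈_/2⌉; NonZero; >-nonZero⁻¹; z≤n; s≤s)
open import Data.Nat.Properties
open import Data.Nat.Logarithm using (⌊log₂_⌋; ⌊log₂⌊n/2⌋⌋≡⌊log₂n⌋∸1)
open import Algebra.Properties.CommutativeSemigroup +-commutativeSemigroup using (x∙yz≈y∙xz; interchange)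
open import Data.Bool using (Bool; true; false; if_then_else_)
open import Data.List using (List; []; _∷_; length; lookup; _++_; filter)
open import Data.List.Properties using (length-++; filter-++; length-filter)
open import Data.List.Relation.Unary.All using (All; []; _∷_)
open import Data.Fin using (Fin; toℕ) renaming (zero to fzero; suc to fsuc)
open import Data.Product using (_,_)
open import Function using (_∘_)
open import Level using (0ℓ)
open import Relation.Nullary using (¬_; yes; no; does; contradiction)
open import Relation.Nullary.Decidable using (dec-true; dec-false)
open import Relation.Unary using (Pred; Decidable)
open import Relation.Binary.PropositionalEquality

2*⌊n/2⌋≤n : ∀ n → 2 * ⌊ n /2⌋ ≤ n
2*⌊n/2⌋≤n n = begin
  ⌊ n /2⌋ + (⌊ n /2⌋ + 0) ≡⟨ cong (⌊ n /2⌋ +_) (+-identityʳ _) ⟩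
  ⌊ n /2⌋ + ⌊ n /2⌋       ≤⟨ +-monoʳ-≤ ⌊ n /2⌋ (⌊n/2⌋≤⌈n/2⌉ n) ⟩
  ⌊ n /2⌋ + ⌈ n /2⌉       ≡⟨ ⌊n/2⌋+⌈n/2⌉≡n n ⟩
  n                       ∎
  where open ≤-Reasoning

m≤⌊log₂n⌋⇒2^m≤n : ∀ m n .{{_ : NonZero n}} → m ≤ ⌊log₂ n ⌋ → 2 ^ m ≤ n
m≤⌊log₂n⌋⇒2^m≤n zero    n             _ = >-nonZero⁻¹ n
m≤⌊log₂n⌋⇒2^m≤n (suc m) (suc (suc n)) 1+m≤log = begin
  2 * 2 ^ m          ≤⟨ *-monoʳ-≤ 2 (m≤⌊log₂n⌋⇒2^m≤n m (suc ⌊ n /2⌋) m≤log-half) ⟩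
  2 * ⌊ 2 + n /2⌋    ≤⟨ 2*⌊n/2⌋≤n (2 + n) ⟩
  2 + n              ∎
  where
  open ≤-Reasoning
  m≤log-half : m ≤ ⌊log₂ ⌊ 2 + n /2⌋ ⌋
  m≤log-half = subst (m ≤_) (sym (⌊log₂⌊n/2⌋⌋≡⌊log₂n⌋∸1 (2 + n))) (∸-monoˡ-≤ 1 1+m≤log)

2≤m≤1⊔n⇒m≤n : ∀ {m} n → 2 ≤ m → m ≤ 1 ⊔ n → m ≤ n
2≤m≤1⊔n⇒m≤n zero          2≤m m≤1 = contradiction m≤1 (<⇒≱ 2≤m)
2≤m≤1⊔n⇒m≤n (suc zero)    2≤m m≤1 = contradiction m≤1 (<⇒≱ 2≤m)
2≤m≤1⊔n⇒m≤n (suc (suc n)) _   m≤n = m≤n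

2≤m≤⌊lg⌋n⇒2^m≤n : ∀ {m} n → 2 ≤ m → m ≤ ⌊lg n ⌋ → 2 ^ m ≤ n
2≤m≤⌊lg⌋n⇒2^m≤n zero    2≤m m≤1  = contradiction m≤1 (<⇒≱ 2≤m)
2≤m≤⌊lg⌋n⇒2^m≤n (suc n) 2≤m m≤lg = m≤⌊log₂n⌋⇒2^m≤n _ (suc n) (2≤m≤1⊔n⇒m≤n ⌊log₂ suc n ⌋ 2≤m m≤lg)

2≤2^ : ∀ {k} → 1 ≤ k → 2 ≤ 2 ^ k
2≤2^ 1≤k = ^-monoʳ-≤ 2 1≤k

wc≡k⇒2^2^k≤n : ∀ {k} → 2 ≤ k → ∀ n → wcOf ⌊lg n ⌋ ≡ k → 2 ^ 2 ^ k ≤ n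
wc≡k⇒2^2^k≤n {k} 2≤k n refl =
  2≤m≤⌊lg⌋n⇒2^m≤n n (2≤2^ (≤-trans (s≤s z≤n) 2≤k)) (2≤m≤⌊lg⌋n⇒2^m≤n ⌊lg n ⌋ 2≤k ≤-refl)

m⊓[n+o]≤m⊓n+m⊓o : ∀ m n o → m ⊓ (n + o) ≤ m ⊓ n + m ⊓ o
m⊓[n+o]≤m⊓n+m⊓o m n o with m ≤? n | m ≤? o
... | yes m≤n | _ = begin
  m ⊓ (n + o)     ≤⟨ m⊓n≤m m _ ⟩
  m               ≡⟨ m≤n⇒m⊓n≡m m≤n ⟨
  m ⊓ n           ≤⟨ m≤m+n _ _ ⟩
  m ⊓ n + m ⊓ o   ∎
  where open ≤-Reasoning
... | no _ | yes m≤o = begin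
  m ⊓ (n + o)     ≤⟨ m⊓n≤m m _ ⟩
  m               ≡⟨ m≤n⇒m⊓n≡m m≤o ⟨
  m ⊓ o           ≤⟨ m≤n+m _ _ ⟩
  m ⊓ n + m ⊓ o   ∎
  where open ≤-Reasoning
... | no m≰n | no m≰o = begin
  m ⊓ (n + o)     ≤⟨ m⊓n≤n m _ ⟩
  n + o           ≡⟨ cong₂ _+_ (m≥n⇒m⊓n≡n (≰⇒≥ m≰n)) (m≥n⇒m⊓n≡n (≰⇒≥ m≰o)) ⟨
  m ⊓ n + m ⊓ o   ∎
  where open ≤-Reasoning

size-lookup≤sizes : ∀ ts (i : Fin (length ts)) → size (lookup ts i) ≤ sizes ts
size-lookup≤sizes (t ∷ ts) fzero    = m≤m+n _ _
size-lookup≤sizes (t ∷ ts) (fsuc i) = ≤-trans (size-lookup≤sizes ts i) (m≤n+m _ _)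

apexAt : ℕ → ℕ → Bool
apexAt heavyPos pos = if heavyPos ≡ᵇ pos then false else true

apexAt-≡ : ∀ {heavyPos pos} → heavyPos ≡ pos → apexAt heavyPos pos ≡ false
apexAt-≡ {heavyPos} {pos} eq = cong (if_then false else true) (dec-true (heavyPos ≟ pos) eq)

apexAt-≢ : ∀ {heavyPos pos} → heavyPos ≢ pos → apexAt heavyPos pos ≡ true
apexAt-≢ {heavyPos} {pos} neq = cong (if_then false else true) (dec-false (heavyPos ≟ pos) neq)

γSize : (t : Tree) → HLD t → Bool → ℕ
γSize t h true  = size t
γSize t h false = lightSize t h

γSize≤size : ∀ t h b → γSize t h b ≤ size t
γSize≤size t                 h              true  = ≤-refl
γSize≤size (node [])         leafH          false = ≤-refl
γSize≤size (node (t′ ∷ ts)) (nodeH i _ _)  false = m∸n≤m _ (size (lookup (t′ ∷ ts) i))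

mutual
  length-gammas : ∀ t (h : HLD t) b → length (gammas t h b) ≡ size t
  length-gammas (node []) leafH          b = refl
  length-gammas (node ts) (nodeH i _ hs) b = cong suc (length-gammasChildren (toℕ i) 0 hs)

  length-gammasChildren : ∀ {ts} heavyPos pos (hs : All HLD ts) →
                          length (gammasChildren heavyPos pos hs) ≡ sizes ts
  length-gammasChildren heavyPos pos [] = refl
  length-gammasChildren {t ∷ ts} heavyPos pos (h ∷ hs) = begin
    length (gammas t h _ ++ gammasChildren heavyPos (suc pos) hs)
      ≡⟨ length-++ (gammas t h _) ⟩
    length (gammas t h _) + length (gammasChildren heavyPos (suc pos) hs)
      ≡⟨ cong₂ _+_ (length-gammas t h _) (length-gammasChildren heavyPos (suc pos) hs) ⟩
    size t + sizes ts
      ∎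
    where open ≡-Reasoning

countWC≤size : ∀ T (H : HLD T) k → countWC T H k ≤ size T
countWC≤size T H k = begin
  countWC T H k              ≤⟨ length-filter (λ g → wcOf g ≟ k) (gammas T H true) ⟩
  length (gammas T H true)   ≡⟨ length-gammas T H true ⟩
  size T                     ∎
  where open ≤-Reasoning

module Charging {P : Pred ℕ 0ℓ} (P? : Decidable P) (M : ℕ)
                (large-if-P : ∀ s → P ⌊lg s ⌋ → M ≤ s) where

  count : List ℕ → ℕ
  count gs = length (filter P? gs)

  count-++ : ∀ xs ys → count (xs ++ ys) ≡ count xs + count ys
  count-++ xs ys = trans (cong length (filter-++ P? xs ys)) (length-++ (filter P? xs))

  large-if-counted : ∀ t h b → P (γ t h b) → M ≤ γSize t h b
  large-if-counted t h true  = large-if-P _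
  large-if-counted t h false = large-if-P _

  cap : Bool → ℕ
  cap true  = M
  cap false = 2 * M

  credit : Bool → ℕ → ℕ
  credit b n = if does (M ≤? n) then cap b else 3 * n

  credits : ℕ → ℕ → List Tree → ℕ
  credits heavyPos pos []       = 0
  credits heavyPos pos (t ∷ ts) = credit (apexAt heavyPos pos) (size t) + credits heavyPos (suc pos) ts

  cap≤2M : ∀ b → cap b ≤ 2 * M
  cap≤2M true  = m≤m+n M (M + 0)
  cap≤2M false = ≤-refl

  M≤cap : ∀ b → M ≤ cap b
  M≤cap true  = ≤-refl
  M≤cap false = m≤m+n M (M + 0)

  credit-large : ∀ b {n} → M ≤ n → credit b n ≡ cap b
  credit-large b {n} M≤n = cong (if_then cap b else 3 * n) (dec-true (M ≤? n) M≤n)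

  credit-small : ∀ b {n} → n < M → credit b n ≡ 3 * n
  credit-small b {n} n<M = cong (if_then cap b else 3 * n) (dec-false (M ≤? n) (<⇒≱ n<M))

  credit≤2M : ∀ b {n} → M ≤ n → credit b n ≤ 2 * M
  credit≤2M b M≤n = ≤-trans (≤-reflexive (credit-large b M≤n)) (cap≤2M b)

  credit≤3n : ∀ b n → credit b n ≤ 3 * n
  credit≤3n b n with M ≤? n
  ... | yes M≤n = begin
    credit b n   ≤⟨ credit≤2M b M≤n ⟩
    2 * M        ≤⟨ *-mono-≤ (n≤1+n 2) M≤n ⟩
    3 * n        ∎
    where open ≤-Reasoning
  ... | no  M≰n = ≤-reflexive (credit-small b (≰⇒> M≰n))

  M⊓3n≤credit : ∀ b n → M ⊓ (3 * n) ≤ credit b n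
  M⊓3n≤credit b n with M ≤? n
  ... | yes M≤n = begin
    M ⊓ (3 * n)   ≤⟨ m⊓n≤m M _ ⟩
    M             ≤⟨ M≤cap b ⟩
    cap b         ≡⟨ credit-large b M≤n ⟨
    credit b n    ∎
    where open ≤-Reasoning
  ... | no  M≰n = ≤-trans (m⊓n≤n M _) (≤-reflexive (sym (credit-small b (≰⇒> M≰n))))

  M+credit≤3n : ∀ b {n} → M ≤ n → M + credit b n ≤ 3 * n
  M+credit≤3n b {n} M≤n = begin
    M + credit b n   ≤⟨ +-monoʳ-≤ M (credit≤2M b M≤n) ⟩
    3 * M            ≤⟨ *-monoʳ-≤ 3 M≤n ⟩
    3 * n            ∎
    where open ≤-Reasoning

  credits-small : ∀ heavyPos pos ts → (∀ j → size (lookup ts j) < M) →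
                  credits heavyPos pos ts ≡ 3 * sizes ts
  credits-small heavyPos pos []       _     = refl
  credits-small heavyPos pos (t ∷ ts) small = begin
    credit (apexAt heavyPos pos) (size t) + credits heavyPos (suc pos) ts
      ≡⟨ cong₂ _+_ (credit-small (apexAt heavyPos pos) (small fzero))
                   (credits-small heavyPos (suc pos) ts (small ∘ fsuc)) ⟩
    3 * size t + 3 * sizes ts
      ≡⟨ *-distribˡ-+ 3 (size t) (sizes ts) ⟨
    3 * (size t + sizes ts)
      ∎
    where open ≡-Reasoning

  credits-light : ∀ heavyPos pos ts → heavyPos < pos → M ⊓ (3 * sizes ts) ≤ credits heavyPos pos ts
  credits-light heavyPos pos []       _  = m⊓n≤n M 0
  credits-light heavyPos pos (t ∷ ts) lt = begin
    M ⊓ (3 * (size t + sizes ts))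
      ≡⟨ cong (M ⊓_) (*-distribˡ-+ 3 (size t) (sizes ts)) ⟩
    M ⊓ (3 * size t + 3 * sizes ts)
      ≤⟨ m⊓[n+o]≤m⊓n+m⊓o M _ _ ⟩
    M ⊓ (3 * size t) + M ⊓ (3 * sizes ts)
      ≤⟨ +-mono-≤ (M⊓3n≤credit true (size t)) (credits-light heavyPos (suc pos) ts (m<n⇒m<1+n lt)) ⟩
    credit true (size t) + credits heavyPos (suc pos) ts
      ≡⟨ cong (λ b → credit b (size t) + credits heavyPos (suc pos) ts) (apexAt-≢ (<⇒≢ lt)) ⟨
    credits heavyPos pos (t ∷ ts)
      ∎
    where open ≤-Reasoning

  M≤3+M⊓3n : ∀ {n} → M ≤ suc n → M ≤ 3 + M ⊓ (3 * n)
  M≤3+M⊓3n {n} M≤1+n with M ≤? 3 * n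
  ... | yes M≤3n = ≤-trans (≤-reflexive (sym (m≤n⇒m⊓n≡m M≤3n))) (m≤n+m _ 3)
  ... | no  M≰3n = begin
    M                  ≤⟨ M≤1+n ⟩
    1 + n              ≤⟨ +-mono-≤ (s≤s z≤n) (m≤m*n n 3) ⟩
    3 + n * 3          ≡⟨ cong (3 +_) (*-comm n 3) ⟩
    3 + 3 * n          ≡⟨ cong (3 +_) (m≥n⇒m⊓n≡n (≰⇒≥ M≰3n)) ⟨
    3 + M ⊓ (3 * n)    ∎
    where open ≤-Reasoning

  credits-heavy : ∀ heavyPos pos ts (i : Fin (length ts)) → heavyPos ≡ pos + toℕ i →
                  M ≤ size (lookup ts i) →
                  2 * M + M ⊓ (3 * (sizes ts ∸ size (lookup ts i))) ≤ credits heavyPos pos ts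
  credits-heavy heavyPos pos (t ∷ ts) fzero eq large = begin
    2 * M + M ⊓ (3 * (size t + sizes ts ∸ size t))
      ≡⟨ cong (λ x → 2 * M + M ⊓ (3 * x)) (m+n∸m≡n (size t) (sizes ts)) ⟩
    2 * M + M ⊓ (3 * sizes ts)
      ≤⟨ +-mono-≤ (≤-reflexive (sym (credit-large false large)))
                  (credits-light heavyPos (suc pos) ts (s≤s (≤-reflexive heavyPos≡pos))) ⟩
    credit false (size t) + credits heavyPos (suc pos) ts
      ≡⟨ cong (λ b → credit b (size t) + credits heavyPos (suc pos) ts) (apexAt-≡ heavyPos≡pos) ⟨
    credits heavyPos pos (t ∷ ts)
      ∎
    where
    open ≤-Reasoning
    heavyPos≡pos : heavyPos ≡ pos
    heavyPos≡pos = trans eq (+-identityʳ pos)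
  credits-heavy heavyPos pos (t ∷ ts) (fsuc i) eq large = begin
    2 * M + M ⊓ (3 * (size t + sizes ts ∸ size (lookup ts i)))
      ≡⟨ cong (λ x → 2 * M + M ⊓ (3 * x)) (+-∸-assoc (size t) (size-lookup≤sizes ts i)) ⟩
    2 * M + M ⊓ (3 * (size t + light))
      ≡⟨ cong (λ x → 2 * M + M ⊓ x) (*-distribˡ-+ 3 (size t) light) ⟩
    2 * M + M ⊓ (3 * size t + 3 * light)
      ≤⟨ +-monoʳ-≤ (2 * M) (m⊓[n+o]≤m⊓n+m⊓o M _ _) ⟩
    2 * M + (M ⊓ (3 * size t) + M ⊓ (3 * light))
      ≡⟨ x∙yz≈y∙xz (2 * M) (M ⊓ (3 * size t)) (M ⊓ (3 * light)) ⟩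
    M ⊓ (3 * size t) + (2 * M + M ⊓ (3 * light))
      ≤⟨ +-mono-≤ (M⊓3n≤credit true (size t)) (credits-heavy heavyPos (suc pos) ts i eq′ large) ⟩
    credit true (size t) + credits heavyPos (suc pos) ts
      ≡⟨ cong (λ b → credit b (size t) + credits heavyPos (suc pos) ts) (apexAt-≢ heavyPos≢pos) ⟨
    credits heavyPos pos (t ∷ ts)
      ∎
    where
    open ≤-Reasoning
    light : ℕ
    light = sizes ts ∸ size (lookup ts i)
    eq′ : heavyPos ≡ suc pos + toℕ i
    eq′ = trans eq (+-suc pos (toℕ i))
    heavyPos≢pos : heavyPos ≢ pos
    heavyPos≢pos heavyPos≡pos = m≢1+m+n pos (trans (sym heavyPos≡pos) eq′)

  module RootCharge (ts : List Tree) (i : Fin (length ts))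
                    (heaviest : ∀ j → size (lookup ts j) ≤ size (lookup ts i)) where

    n S : ℕ
    n = suc (sizes ts)
    S = credits (toℕ i) 0 ts

    3+S≡3n : ¬ M ≤ size (lookup ts i) → 3 + S ≡ 3 * n
    3+S≡3n small = begin
      3 + S              ≡⟨ cong (3 +_) (credits-small (toℕ i) 0 ts (λ j → ≤-<-trans (heaviest j) (≰⇒> small))) ⟩
      3 + 3 * sizes ts   ≡⟨ *-suc 3 (sizes ts) ⟨
      3 * n              ∎
      where open ≡-Reasoning

    M≤n : M ≤ size (lookup ts i) → M ≤ n
    M≤n large = ≤-trans large (≤-trans (size-lookup≤sizes ts i) (n≤1+n _))

    2M≤S : M ≤ size (lookup ts i) → 2 * M ≤ S
    2M≤S large = ≤-trans (m≤m+n _ _) (credits-heavy (toℕ i) 0 ts i refl large)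

    uncounted : ∀ b → credit b n ≤ 3 + S
    uncounted b with M ≤? size (lookup ts i)
    ... | no small  = ≤-trans (credit≤3n b n) (≤-reflexive (sym (3+S≡3n small)))
    ... | yes large = ≤-trans (credit≤2M b (M≤n large)) (≤-trans (2M≤S large) (m≤n+m S 3))

    counted : ∀ hs b → M ≤ γSize (node ts) (nodeH i heaviest hs) b → M + credit b n ≤ 3 + S
    counted hs b M≤γSize with M ≤? size (lookup ts i)
    ... | no small = ≤-trans (M+credit≤3n b (≤-trans M≤γSize (γSize≤size _ _ b)))
                             (≤-reflexive (sym (3+S≡3n small)))
    counted hs true  _ | yes large = begin
      M + credit true n   ≡⟨ cong (M +_) (credit-large true (M≤n large)) ⟩
      M + M               ≡⟨ cong (M +_) (+-identityʳ M) ⟨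
      2 * M               ≤⟨ 2M≤S large ⟩
      S                   ≤⟨ m≤n+m S 3 ⟩
      3 + S               ∎
      where open ≤-Reasoning
    -- The light subtree has at least M nodes, so the root's 3 units and the light children's credits cover M.
    counted hs false M≤light | yes large = begin
      M + credit false n             ≡⟨ cong (M +_) (credit-large false (M≤n large)) ⟩
      M + 2 * M                      ≡⟨ +-comm M (2 * M) ⟩
      2 * M + M                      ≤⟨ +-monoʳ-≤ (2 * M) (M≤3+M⊓3n M≤1+light) ⟩
      2 * M + (3 + M ⊓ (3 * light))  ≡⟨ x∙yz≈y∙xz (2 * M) 3 _ ⟩
      3 + (2 * M + M ⊓ (3 * light))  ≤⟨ +-monoʳ-≤ 3 (credits-heavy (toℕ i) 0 ts i refl large) ⟩
      3 + S                          ∎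
      where
      open ≤-Reasoning
      light : ℕ
      light = sizes ts ∸ size (lookup ts i)
      M≤1+light : M ≤ suc light
      M≤1+light = ≤-trans M≤light (≤-reflexive (+-∸-assoc 1 (size-lookup≤sizes ts i)))

  add-root : ∀ c {S x s} → c * M + S ≤ 3 * s → x ≤ 3 + S → c * M + x ≤ 3 * suc s
  add-root c {S} {x} {s} children root = begin
    c * M + x          ≤⟨ +-monoʳ-≤ (c * M) root ⟩
    c * M + (3 + S)    ≡⟨ x∙yz≈y∙xz (c * M) 3 S ⟩
    3 + (c * M + S)    ≤⟨ +-monoʳ-≤ 3 children ⟩
    3 + 3 * s          ≡⟨ *-suc 3 s ⟨
    3 * suc s          ∎
    where open ≤-Reasoning

  mutual
    charge : ∀ t (h : HLD t) b → count (gammas t h b) * M + credit b (size t) ≤ 3 * size t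
    charge (node []) leafH b with P? (γ (node []) leafH b)
    ... | yes counted = begin
      (M + 0) + credit b 1   ≡⟨ cong (_+ credit b 1) (+-identityʳ M) ⟩
      M + credit b 1         ≤⟨ M+credit≤3n b (≤-trans (large-if-counted (node []) leafH b counted) (γSize≤size _ leafH b)) ⟩
      3 * 1                  ∎
      where open ≤-Reasoning
    ... | no _ = credit≤3n b 1
    charge (node ts) h@(nodeH i heaviest hs) b with P? (γ (node ts) h b)
    ... | yes counted = begin
      (M + c * M) + credit b n   ≡⟨ +-assoc M (c * M) (credit b n) ⟩
      M + (c * M + credit b n)   ≡⟨ x∙yz≈y∙xz M (c * M) (credit b n) ⟩
      c * M + (M + credit b n)   ≤⟨ add-root c (charge-children (toℕ i) 0 hs)
                                      (RootCharge.counted ts i heaviest hs b (large-if-counted (node ts) h b counted)) ⟩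
      3 * n                      ∎
      where
      open ≤-Reasoning
      n c : ℕ
      n = size (node ts)
      c = count (gammasChildren (toℕ i) 0 hs)
    ... | no _ = add-root (count (gammasChildren (toℕ i) 0 hs)) (charge-children (toℕ i) 0 hs) (RootCharge.uncounted ts i heaviest b)

    charge-children : ∀ {ts} heavyPos pos (hs : All HLD ts) →
                      count (gammasChildren heavyPos pos hs) * M + credits heavyPos pos ts ≤ 3 * sizes ts
    charge-children heavyPos pos [] = z≤n
    charge-children {t ∷ ts} heavyPos pos (h ∷ hs) = begin
      count (gammas t h b ++ rest) * M + (credit b (size t) + S)
        ≡⟨ cong (λ c → c * M + (credit b (size t) + S)) (count-++ (gammas t h b) rest) ⟩
      (count (gammas t h b) + count rest) * M + (credit b (size t) + S)
        ≡⟨ cong (_+ (credit b (size t) + S)) (*-distribʳ-+ M (count (gammas t h b)) (count rest)) ⟩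
      (count (gammas t h b) * M + count rest * M) + (credit b (size t) + S)
        ≡⟨ interchange (count (gammas t h b) * M) (count rest * M) (credit b (size t)) S ⟩
      (count (gammas t h b) * M + credit b (size t)) + (count rest * M + S)
        ≤⟨ +-mono-≤ (charge t h b) (charge-children heavyPos (suc pos) hs) ⟩
      3 * size t + 3 * sizes ts
        ≡⟨ *-distribˡ-+ 3 (size t) (sizes ts) ⟨
      3 * (size t + sizes ts)
        ∎
      where
      open ≤-Reasoning
      b : Bool
      b = apexAt heavyPos pos
      rest : List ℕ
      rest = gammasChildren heavyPos (suc pos) hs
      S : ℕ
      S = credits heavyPos (suc pos) ts

  count-bound : ∀ t (h : HLD t) → count (gammas t h true) * M ≤ 3 * size t
  count-bound t h = ≤-trans (m≤m+n _ _) (charge t h true)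

countWC-trivial-bound : ∀ T (H : HLD T) k → 2 ^ 2 ^ k ≤ 3 * 2 ^ k →
                        countWC T H k * 2 ^ 2 ^ k ≤ 3 * size T * 2 ^ k
countWC-trivial-bound T H k small = begin
  countWC T H k * 2 ^ 2 ^ k   ≤⟨ *-mono-≤ (countWC≤size T H k) small ⟩
  size T * (3 * 2 ^ k)        ≡⟨ *-assoc (size T) 3 (2 ^ k) ⟨
  size T * 3 * 2 ^ k          ≡⟨ cong (_* 2 ^ k) (*-comm (size T) 3) ⟩
  3 * size T * 2 ^ k          ∎
  where open ≤-Reasoning

lemma9 : ∃[ C ] ∀ (T : Tree) (H : HLD T) (k : ℕ) →
           countWC T H k * 2 ^ (2 ^ k) ≤ C * size T * 2 ^ k
lemma9 = 3 , bound
  where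
  bound : ∀ T (H : HLD T) k → countWC T H k * 2 ^ 2 ^ k ≤ 3 * size T * 2 ^ k
  bound T H 0 = countWC-trivial-bound T H 0 (n≤1+n 2)
  bound T H 1 = countWC-trivial-bound T H 1 (m≤m+n 4 2)
  bound T H k@(suc (suc _)) = begin
    countWC T H k * 2 ^ 2 ^ k   ≤⟨ Charging.count-bound (λ g → wcOf g ≟ k) (2 ^ 2 ^ k)
                                     (wc≡k⇒2^2^k≤n (s≤s (s≤s z≤n))) T H ⟩
    3 * size T                  ≤⟨ m≤m*n (3 * size T) (2 ^ k) {{m^n≢0 2 k}} ⟩
    3 * size T * 2 ^ k          ∎
    where open ≤-Reasoning
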